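{- Let $G$ be a triangle-free graph on $n$ vertices with minimum degree $\delta$. Let $r \geq 4$ and suppose $U \subset V(G)$ with $|U|=2r$ is such that the auxiliary graph $H$ with vertex set $U$, in which two vertices are adjacent if and only if their distance in $G$ is exactly $2$, is a disjoint union of two cycles of length $r$. Then $n \geq 2\left\lceil \frac{r\delta}{2}\right\rceil$.
   Context: Graphs are finite and simple; distances are graph distances in $G$. -}

module Defs where

open import Data.Nat using (ℕ; zero; suc; _+_; _*_; _≤_; _/_)
open import Data.Fin using (Fin; toℕ)
open import Data.Bool using (Bool; true; false)
open import Data.List using (length; filterᵇ; allFin)
open import Data.Product using (Σ; ∃; _×_; _,_)
open import Data.Sum using (_⊎_)
open import Data.Empty using (⊥)
open import Relation.Binary.PropositionalEquality using (_≡_; _≢_)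

record Graph (n : ℕ) : Set where
  field
    adj    : Fin n → Fin n → Bool
    sym    : ∀ u v → adj u v ≡ adj v u
    irrefl : ∀ v → adj v v ≡ false
open Graph public

degree : ∀ {n} → Graph n → Fin n → ℕ
degree G v = length (filterᵇ (adj G v) (allFin _))

MinDegree : ∀ {n} → Graph n → ℕ → Set
MinDegree G δ = (∀ v → δ ≤ degree G v) × (∃ λ v → degree G v ≡ δ)

TriangleFree : ∀ {n} → Graph n → Set
TriangleFree G = ∀ u v w → adj G u v ≡ true → adj G v w ≡ true → adj G u w ≡ true → ⊥

Dist2 : ∀ {n} → Graph n → Fin n → Fin n → Set
Dist2 G u v = u ≢ v × adj G u v ≡ false × (∃ λ w → adj G u w ≡ true × adj G w v ≡ true)

CycAdj : (r : ℕ) → Fin r → Fin r → Set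
CycAdj r i j = suc (toℕ i) ≡ toℕ j ⊎ suc (toℕ j) ≡ toℕ i
             ⊎ (toℕ i ≡ 0 × suc (toℕ j) ≡ r) ⊎ (toℕ j ≡ 0 × suc (toℕ i) ≡ r)

ceilHalf : ℕ → ℕ
ceilHalf m = (m + 1) / 2

-- Each vertex w of G is adjacent to at most two vertices of either cycle: any two
-- neighbours of w are at distance 2 (G is triangle-free), so three of them would
-- form a triangle in C_r. And w cannot see both cycles, since vertices of different
-- cycles are never at distance 2. Double counting the edges leaving a cycle gives
-- r δ ≤ 2 |N(C)|, so the two disjoint neighbourhoods have at least ⌈r δ / 2⌉
-- vertices each.
module Submission where

open import Defs
open import Data.Bool using (Bool; true; false)
open import Data.Bool.Properties using (¬-not) renaming (_≟_ to _≟ᵇ_)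
open import Data.Empty using (⊥; ⊥-elim)
open import Data.Fin using (Fin; toℕ)
import Data.Fin as Fin
open import Data.Fin.Patterns using (0F; 1F)
open import Data.Fin.Properties using (toℕ<n; toℕ-injective; suc-injective; any?)
open import Data.List using (length; filterᵇ; tabulate)
open import Data.Nat using (ℕ; zero; suc; _+_; _*_; _⊓_; _≤_; _<_; z≤n; s≤s)
open import Data.Nat.DivMod using (m<n*o⇒m/o<n)
open import Data.Nat.Properties
  using (+-*-semiring; module ≤-Reasoning; ≤-reflexive; ≤-trans; ≤-pred; <-irrefl; n<1+n;
         +-identityʳ; *-identityʳ; +-mono-≤; +-monoˡ-≤; m⊓n≤m)
open import Data.Nat.Tactic.RingSolver using (solve-∀)
open import Data.Product using (_×_; _,_; ∃; proj₁; proj₂)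
open import Data.Sum using (_⊎_; inj₁; inj₂)
open import Function using (_∘_; id)
open import Function.Bundles using (_⇔_; Equivalence)
open import Relation.Binary.PropositionalEquality as ≡ using (_≡_; _≢_; refl; cong)
open import Relation.Nullary using (yes; no)

open import Algebra.Properties.Semiring.Sum +-*-semiring
  using (sum-syntax; sum-cong-≗; ∑-comm; ∑-distrib-+; *-distribˡ-sum)

Next : ℕ → ℕ → ℕ → Set
Next r x y = suc x ≡ y ⊎ (suc x ≡ r × y ≡ 0)

next-functional : ∀ {r x y z} → y < r → z < r → Next r x y → Next r x z → y ≡ z
next-functional _   _   (inj₁ refl)       (inj₁ refl)       = refl
next-functional y<r _   (inj₁ refl)       (inj₂ (refl , _)) = ⊥-elim (<-irrefl refl y<r)
next-functional _   z<r (inj₂ (refl , _)) (inj₁ refl)       = ⊥-elim (<-irrefl refl z<r)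
next-functional _   _   (inj₂ (_ , refl)) (inj₂ (_ , refl)) = refl

next-injective : ∀ {r x y z} → Next r x z → Next r y z → x ≡ y
next-injective (inj₁ refl)          (inj₁ refl)          = refl
next-injective (inj₁ refl)          (inj₂ (_ , ()))
next-injective (inj₂ (_ , refl))    (inj₁ ())
next-injective (inj₂ (refl , refl)) (inj₂ (refl , refl)) = refl

no-directed-triangle : ∀ {r x y z} → 4 ≤ r → Next r x y → Next r y z → Next r z x → ⊥
no-directed-triangle _ (inj₁ refl) (inj₁ refl) (inj₁ ())
no-directed-triangle (s≤s (s≤s (s≤s ()))) (inj₁ refl) (inj₁ refl) (inj₂ (refl , refl))
no-directed-triangle (s≤s (s≤s (s≤s ()))) (inj₁ refl) (inj₂ (refl , refl)) (inj₁ refl)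
no-directed-triangle (s≤s (s≤s (s≤s ()))) (inj₂ (refl , refl)) (inj₁ refl) (inj₁ refl)
no-directed-triangle _ (inj₁ refl) (inj₂ (refl , refl)) (inj₂ (() , _))
no-directed-triangle (s≤s (s≤s _)) (inj₂ (refl , refl)) (inj₂ (() , _)) _

cycAdj⇒next : ∀ {r} {i j : Fin r} → CycAdj r i j → Next r (toℕ i) (toℕ j) ⊎ Next r (toℕ j) (toℕ i)
cycAdj⇒next (inj₁ i→j)                         = inj₁ (inj₁ i→j)
cycAdj⇒next (inj₂ (inj₁ j→i))                  = inj₂ (inj₁ j→i)
cycAdj⇒next (inj₂ (inj₂ (inj₁ (i≡0 , j≡r-1)))) = inj₂ (inj₂ (j≡r-1 , i≡0))
cycAdj⇒next (inj₂ (inj₂ (inj₂ (j≡0 , i≡r-1)))) = inj₁ (inj₂ (i≡r-1 , j≡0))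

cycAdj-triangle-free : ∀ {r} → 4 ≤ r → {i j k : Fin r} → i ≢ j → j ≢ k → i ≢ k →
                       CycAdj r i j → CycAdj r j k → CycAdj r i k → ⊥
cycAdj-triangle-free {r} 4≤r {i} {j} {k} i≢j j≢k i≢k ij jk ik =
  orient (cycAdj⇒next ij) (cycAdj⇒next jk) (cycAdj⇒next ik)
  where
  x y z : ℕ
  x = toℕ i
  y = toℕ j
  z = toℕ k

  -- A non-cyclic orientation of the triangle has a vertex with two successors or
  -- two predecessors on C_r.
  orient : Next r x y ⊎ Next r y x → Next r y z ⊎ Next r z y → Next r x z ⊎ Next r z x → ⊥
  orient (inj₁ x→y) _           (inj₁ x→z) = j≢k (toℕ-injective (next-functional (toℕ<n j) (toℕ<n k) x→y x→z))
  orient (inj₁ x→y) (inj₁ y→z)  (inj₂ z→x) = no-directed-triangle 4≤r x→y y→z z→x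
  orient (inj₁ x→y) (inj₂ z→y)  _          = i≢k (toℕ-injective (next-injective x→y z→y))
  orient (inj₂ y→x) (inj₁ y→z)  _          = i≢k (toℕ-injective (next-functional (toℕ<n i) (toℕ<n k) y→x y→z))
  orient (inj₂ y→x) (inj₂ z→y)  (inj₁ x→z) = no-directed-triangle 4≤r x→z z→y y→x
  orient (inj₂ y→x) (inj₂ z→y)  (inj₂ z→x) = i≢j (toℕ-injective (next-functional (toℕ<n i) (toℕ<n j) z→x z→y))

∑-const : ∀ m c → ∑[ i < m ] c ≡ m * c
∑-const zero    c = refl
∑-const (suc m) c = cong (c +_) (∑-const m c)

∑-mono-≤ : ∀ {m} {f g : Fin m → ℕ} → (∀ i → f i ≤ g i) → ∑[ i < m ] f i ≤ ∑[ i < m ] g i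
∑-mono-≤ {zero}  f≤g = z≤n
∑-mono-≤ {suc m} f≤g = +-mono-≤ (f≤g Fin.zero) (∑-mono-≤ (f≤g ∘ Fin.suc))

indicator : Bool → ℕ
indicator true  = 1
indicator false = 0

count : ∀ {m} → (Fin m → Bool) → ℕ
count {m} p = ∑[ i < m ] indicator (p i)

length-filterᵇ-tabulate : ∀ {A : Set} {m} (p : A → Bool) (g : Fin m → A) →
                          length (filterᵇ p (tabulate g)) ≡ count (p ∘ g)
length-filterᵇ-tabulate {m = zero}  p g = refl
length-filterᵇ-tabulate {m = suc m} p g with p (g Fin.zero)
... | true  = cong suc (length-filterᵇ-tabulate p (g ∘ Fin.suc))
... | false = length-filterᵇ-tabulate p (g ∘ Fin.suc)

count-none : ∀ {m} (p : Fin m → Bool) → (∀ i → p i ≡ false) → count p ≡ 0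
count-none {zero}  p none = refl
count-none {suc m} p none rewrite none Fin.zero = count-none (p ∘ Fin.suc) (none ∘ Fin.suc)

count-zero-or-witness : ∀ {m} (p : Fin m → Bool) → count p ≡ 0 ⊎ ∃ λ i → p i ≡ true
count-zero-or-witness p with any? (λ i → p i ≟ᵇ true)
... | yes witness = inj₂ witness
... | no  nothing = inj₁ (count-none p (λ i → ¬-not (λ pi → nothing (i , pi))))

count≤1 : ∀ {m} (p : Fin m → Bool) → (∀ {i j} → p i ≡ true → p j ≡ true → i ≡ j) → count p ≤ 1
count≤1 {zero}  p unique = z≤n
count≤1 {suc m} p unique with p Fin.zero in p0
... | true  = ≤-reflexive (cong suc (count-none (p ∘ Fin.suc) (λ i → ¬-not (λ pi → zero≢suc (unique p0 pi)))))
  where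
  zero≢suc : ∀ {i : Fin m} → Fin.zero ≢ Fin.suc i
  zero≢suc ()
... | false = count≤1 (p ∘ Fin.suc) (λ pi pj → suc-injective (unique pi pj))

count≤2 : ∀ {m} (p : Fin m → Bool) →
          (∀ {i j k} → p i ≡ true → p j ≡ true → p k ≡ true → i ≢ j → j ≢ k → i ≢ k → ⊥) →
          count p ≤ 2
count≤2 {zero}  p no-three = z≤n
count≤2 {suc m} p no-three with p Fin.zero in p0
... | true  = s≤s (count≤1 (p ∘ Fin.suc) unique)
  where
  unique : ∀ {i j} → p (Fin.suc i) ≡ true → p (Fin.suc j) ≡ true → i ≡ j
  unique {i} {j} pi pj with i Fin.≟ j
  ... | yes i≡j = i≡j
  ... | no  i≢j = ⊥-elim (no-three p0 pi pj (λ ()) (i≢j ∘ suc-injective) (λ ()))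
... | false = count≤2 (p ∘ Fin.suc) (λ pi pj pk i≢j j≢k i≢k →
                no-three pi pj pk (i≢j ∘ suc-injective) (j≢k ∘ suc-injective) (i≢k ∘ suc-injective))

ceilHalf-least : ∀ {m k} → m ≤ 2 * k → ceilHalf m ≤ k
ceilHalf-least {m} {k} m≤2k = ≤-pred (m<n*o⇒m/o<n (begin-strict
  m + 1           ≤⟨ +-monoˡ-≤ 1 m≤2k ⟩
  2 * k + 1       <⟨ n<1+n _ ⟩
  suc (2 * k + 1) ≡⟨ 2+2k≡[1+k]*2 k ⟩
  suc k * 2       ∎))
  where
  open ≤-Reasoning
  2+2k≡[1+k]*2 : ∀ k → suc (2 * k + 1) ≡ suc k * 2
  2+2k≡[1+k]*2 = solve-∀

module _ {n} (G : Graph n) where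

  neighbours-in : ∀ {m} → (Fin m → Fin n) → Fin n → ℕ
  neighbours-in g w = count (λ i → adj G (g i) w)

  -- 1 ⊓ d is the indicator of d > 0, so this counts the vertices adjacent to some g i
  neighbourhood-size : ∀ {m} → (Fin m → Fin n) → ℕ
  neighbourhood-size g = ∑[ w < n ] (1 ⊓ neighbours-in g w)

  ∑-degree≡∑-neighbours-in : ∀ {m} (g : Fin m → Fin n) →
                            ∑[ i < m ] degree G (g i) ≡ ∑[ w < n ] neighbours-in g w
  ∑-degree≡∑-neighbours-in g = ≡.trans
    (sum-cong-≗ (λ i → length-filterᵇ-tabulate (adj G (g i)) id))
    (∑-comm (λ i w → indicator (adj G (g i) w)))

  min-degree≤neighbourhood-size : ∀ {m δ} (g : Fin m → Fin n) → (∀ v → δ ≤ degree G v) →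
                                  (∀ w → neighbours-in g w ≤ 2) → m * δ ≤ 2 * neighbourhood-size g
  min-degree≤neighbourhood-size {m} {δ} g δ≤degree ≤2 = begin
    m * δ                                     ≡⟨ ∑-const m δ ⟨
    ∑[ i < m ] δ                              ≤⟨ ∑-mono-≤ (δ≤degree ∘ g) ⟩
    ∑[ i < m ] degree G (g i)                 ≡⟨ ∑-degree≡∑-neighbours-in g ⟩
    ∑[ w < n ] neighbours-in g w              ≤⟨ ∑-mono-≤ (λ w → ≤2⇒≤2*[1⊓] (≤2 w)) ⟩
    ∑[ w < n ] (2 * (1 ⊓ neighbours-in g w))  ≡⟨ *-distribˡ-sum 2 (λ w → 1 ⊓ neighbours-in g w) ⟨
    2 * neighbourhood-size g                  ∎
    where
    open ≤-Reasoning
    ≤2⇒≤2*[1⊓] : ∀ {d} → d ≤ 2 → d ≤ 2 * (1 ⊓ d)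
    ≤2⇒≤2*[1⊓] {zero}  _ = z≤n
    ≤2⇒≤2*[1⊓] {suc d} (s≤s d≤1) = s≤s (≤-trans d≤1 (s≤s z≤n))

  disjoint-neighbourhood-sizes : ∀ {m m′} (g : Fin m → Fin n) (h : Fin m′ → Fin n) →
                                 (∀ w → neighbours-in g w ≡ 0 ⊎ neighbours-in h w ≡ 0) →
                                 neighbourhood-size g + neighbourhood-size h ≤ n
  disjoint-neighbourhood-sizes g h disjoint = begin
    neighbourhood-size g + neighbourhood-size h                 ≡⟨ ∑-distrib-+ (λ w → 1 ⊓ neighbours-in g w) (λ w → 1 ⊓ neighbours-in h w) ⟨
    ∑[ w < n ] (1 ⊓ neighbours-in g w + 1 ⊓ neighbours-in h w)  ≤⟨ ∑-mono-≤ (λ w → at-most-one (disjoint w)) ⟩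
    ∑[ w < n ] 1                                                ≡⟨ ∑-const n 1 ⟩
    n * 1                                                       ≡⟨ *-identityʳ n ⟩
    n                                                           ∎
    where
    open ≤-Reasoning
    at-most-one : ∀ {d e} → d ≡ 0 ⊎ e ≡ 0 → 1 ⊓ d + 1 ⊓ e ≤ 1
    at-most-one {e = e} (inj₁ refl) = m⊓n≤m 1 e
    at-most-one {d = d} (inj₂ refl) = ≤-trans (≤-reflexive (+-identityʳ _)) (m⊓n≤m 1 d)

  common-neighbour⇒Dist2 : TriangleFree G → ∀ {u v w} → u ≢ v →
                           adj G u w ≡ true → adj G v w ≡ true → Dist2 G u v
  common-neighbour⇒Dist2 triangle-free {u} {v} {w} u≢v uw vw =
    u≢v , ¬-not (λ uv → triangle-free u v w uv vw uw) ,
    w , uw , ≡.trans (sym G w v) vw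

lemma3p5 : ∀ {n} (G : Graph n) (δ r : ℕ)
    → TriangleFree G
    → MinDegree G δ
    → 4 ≤ r
    → (f : Fin 2 × Fin r → Fin n)
    → (∀ x y → f x ≡ f y → x ≡ y)
    → (∀ a i b j → Dist2 G (f (a , i)) (f (b , j)) ⇔ (a ≡ b × CycAdj r i j))
    → 2 * ceilHalf (r * δ) ≤ n
lemma3p5 {n} G δ r triangle-free (δ≤degree , _) 4≤r f f-injective dist2⇔ = begin
  2 * ceilHalf (r * δ)                                          ≡⟨ cong (ceilHalf (r * δ) +_) (+-identityʳ _) ⟩
  ceilHalf (r * δ) + ceilHalf (r * δ)                           ≤⟨ +-mono-≤ (half-bound 0F) (half-bound 1F) ⟩
  neighbourhood-size G (cycle 0F) + neighbourhood-size G (cycle 1F) ≤⟨ disjoint-neighbourhood-sizes G (cycle 0F) (cycle 1F) sees-one-cycle ⟩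
  n                                                             ∎
  where
  open ≤-Reasoning

  cycle : Fin 2 → Fin r → Fin n
  cycle a i = f (a , i)

  common-neighbour⇒cycle-adjacent : ∀ {a b i j w} → (a , i) ≢ (b , j) →
    adj G (cycle a i) w ≡ true → adj G (cycle b j) w ≡ true → a ≡ b × CycAdj r i j
  common-neighbour⇒cycle-adjacent {a} {b} {i} {j} ai≢bj aw bw = Equivalence.to (dist2⇔ a i b j)
    (common-neighbour⇒Dist2 G triangle-free (ai≢bj ∘ f-injective _ _) aw bw)

  sees-at-most-two : ∀ a w → neighbours-in G (cycle a) w ≤ 2
  sees-at-most-two a w = count≤2 _ λ iw jw kw i≢j j≢k i≢k →
    cycAdj-triangle-free 4≤r i≢j j≢k i≢k (adjacent i≢j iw jw) (adjacent j≢k jw kw) (adjacent i≢k iw kw)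
    where
    adjacent : ∀ {i j} → i ≢ j → adj G (cycle a i) w ≡ true → adj G (cycle a j) w ≡ true → CycAdj r i j
    adjacent i≢j iw jw = proj₂ (common-neighbour⇒cycle-adjacent (i≢j ∘ cong proj₂) iw jw)

  sees-one-cycle : ∀ w → neighbours-in G (cycle 0F) w ≡ 0 ⊎ neighbours-in G (cycle 1F) w ≡ 0
  sees-one-cycle w with count-zero-or-witness (λ i → adj G (cycle 0F i) w)
                      | count-zero-or-witness (λ j → adj G (cycle 1F j) w)
  ... | inj₁ none    | _           = inj₁ none
  ... | _            | inj₁ none   = inj₂ none
  ... | inj₂ (_ , iw) | inj₂ (_ , jw) with () ← proj₁ (common-neighbour⇒cycle-adjacent (λ ()) iw jw)

  half-bound : ∀ a → ceilHalf (r * δ) ≤ neighbourhood-size G (cycle a)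
  half-bound a = ceilHalf-least (min-degree≤neighbourhood-size G (cycle a) δ≤degree (sees-at-most-two a))
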